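{- Let $m\ge 2$ and $n\in\mathbb{Z}^{+}$. The Empty Board $F_m$ Black Hole Zeckendorf game with $n$ pieces (defined in the context) is playable, i.e. every play of it ends after finitely many moves, and it always ends at the Zeckendorf decomposition of $n \bmod F_m$: the final board has at most one piece in each column, no two pieces in adjacent columns, and weighted sum of pieces equal to $n \bmod F_m$.
   Context: Fibonacci numbers are indexed as $F_1=1$, $F_2=2$, $F_{k+1}=F_k+F_{k-1}$. The Empty Board $F_m$ Black Hole Zeckendorf game with $n$ pieces is played on a board with columns $F_1,\dots,F_{m-1}$, the column $F_i$ having weight $F_i$. Placement phase: starting from the empty board, two players alternate placing one piece in one of the outermost columns $F_1$ or $F_{m-1}$; placing in column $F_i$ uses up $F_i$ of the remaining $n$, and is allowed only if $F_i$ does not exceed what remains; the phase ends when nothing remains. Decomposition phase: players alternate moves chosen from: (add) remove one piece from each of columns $F_i,F_{i+1}$ and add one piece to column $F_{i+2}$; (merge) remove two pieces from $F_1$ and add one to $F_2$; (split) remove two pieces from $F_2$ and add one to each of $F_1$ and $F_3$, or, for $i\ge3$, remove two pieces from $F_i$ and add one to each of $F_{i-2}$ and $F_{i+1}$. Any piece that would be placed in a column $F_j$ with $j\ge m$ (the "black hole") is instead permanently removed from the board. The last player to move wins. -}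

module Defs where

open import Data.Nat using (ℕ; zero; suc; _+_; _*_; _∸_; _≤_; NonZero)
open import Data.Nat.DivMod using (_%_)
open import Data.Vec using (Vec; []; _∷_; replicate)
open import Data.Product using (_×_; _,_; proj₁; proj₂)
open import Relation.Binary.PropositionalEquality using (_≡_)
open import Relation.Nullary using (¬_)

-- Fibonacci numbers indexed as F 1 = 1, F 2 = 2, F (k+1) = F k + F (k-1).
-- (F 0 = 1 is a filler value, never used: columns are 1-based.)
F : ℕ → ℕ
F zero = 1
F (suc zero) = 1
F (suc (suc zero)) = 2
F (suc (suc (suc k))) = F (suc (suc k)) + F (suc k)

F-nonZero : ∀ k → NonZero (F k)
F-nonZero zero = _
F-nonZero (suc zero) = _
F-nonZero (suc (suc zero)) = _
F-nonZero (suc (suc (suc k))) with F (suc (suc k)) | F-nonZero (suc (suc k))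
... | suc _ | _ = _

_modF_ : ℕ → ℕ → ℕ
n modF m = _%_ n (F m) {{F-nonZero m}}

-- A board for the F_m game: columns F_1, ..., F_{m-1}; entry at Vec
-- position p (0-based) is the number of pieces in column F_{p+1}.
Board : ℕ → Set
Board m = Vec ℕ (m ∸ 1)

getp : ∀ {k} → Vec ℕ k → ℕ → ℕ
getp [] _ = 0
getp (x ∷ xs) zero = x
getp (x ∷ xs) (suc p) = getp xs p

modp : ∀ {k} → (ℕ → ℕ) → ℕ → Vec ℕ k → Vec ℕ k
modp f _ [] = []
modp f zero (x ∷ xs) = f x ∷ xs
modp f (suc p) (x ∷ xs) = x ∷ modp f p xs

-- 1-based column access: number of pieces in column F_i
-- (0 for i = 0 and for columns outside the board).
get : ∀ {k} → Vec ℕ k → ℕ → ℕ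
get b zero = 0
get b (suc p) = getp b p

-- Add one piece to column F_i; if the column is not on the board
-- (i ≥ m, the black hole) the piece is removed, i.e. board unchanged.
inc : ∀ {k} → ℕ → Vec ℕ k → Vec ℕ k
inc zero b = b
inc (suc p) b = modp suc p b

-- Remove one piece from column F_i (only used when get b i ≥ 1).
dec : ∀ {k} → ℕ → Vec ℕ k → Vec ℕ k
dec zero b = b
dec (suc p) b = modp (λ x → x ∸ 1) p b

weightFrom : ∀ {k} → ℕ → Vec ℕ k → ℕ
weightFrom i [] = 0
weightFrom i (x ∷ xs) = x * F i + weightFrom (suc i) xs

weight : ∀ {k} → Vec ℕ k → ℕ
weight b = weightFrom 1 b

-- Game state: board together with the amount of n still to be placed.
State : ℕ → Set
State m = Board m × ℕ

initial : (m n : ℕ) → State m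
initial m n = replicate _ 0 , n

data Step (m : ℕ) : State m → State m → Set where
  place-first : ∀ {b r} → F 1 ≤ r →
    Step m (b , r) (inc 1 b , r ∸ F 1)
  place-last  : ∀ {b r} → F (m ∸ 1) ≤ r →
    Step m (b , r) (inc (m ∸ 1) b , r ∸ F (m ∸ 1))
  add : ∀ {b} i → 1 ≤ i → 1 ≤ get b i → 1 ≤ get b (suc i) →
    Step m (b , 0) (inc (i + 2) (dec (suc i) (dec i b)) , 0)
  merge : ∀ {b} → 2 ≤ get b 1 →
    Step m (b , 0) (inc 2 (dec 1 (dec 1 b)) , 0)
  split2 : ∀ {b} → 2 ≤ get b 2 →
    Step m (b , 0) (inc 3 (inc 1 (dec 2 (dec 2 b))) , 0)
  split : ∀ {b} i → 3 ≤ i → 2 ≤ get b i →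
    Step m (b , 0) (inc (suc i) (inc (i ∸ 2) (dec i (dec i b))) , 0)

Terminal : ∀ m → State m → Set
Terminal m s = ∀ s' → ¬ Step m s s'

IsZeckendorfOf : ∀ {k} → ℕ → Vec ℕ k → Set
IsZeckendorfOf N b =
  (∀ i → get b i ≤ 1) ×
  (∀ i → ¬ (get b i ≡ 1 × get b (suc i) ≡ 1)) ×
  weight b ≡ N

{-# OPTIONS --safe #-}
module Submission where

open import Defs
open import Data.Nat using (ℕ; zero; suc; _+_; _*_; _∸_; _≤_; _<_; z≤n; s≤s; z<s; NonZero)
open import Data.Nat.Properties
open import Data.Nat.DivMod using (_%_; [m+kn]%n≡m%n; m<n⇒m%n≡m)
open import Data.Nat.Induction using (<-wellFounded)
open import Data.Nat.ListAction using (sum)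
open import Data.Nat.Tactic.RingSolver using (solve-∀)
open import Data.List using (List; []; _∷_; foldr; map)
open import Data.List.Relation.Unary.All using (All; []; _∷_)
open import Data.Vec using (Vec; []; _∷_; replicate)
open import Data.Product using (_×_; _,_; proj₁; proj₂; ∃-syntax)
open import Data.Sum using (inj₁; inj₂)
open import Data.Unit using (⊤; tt)
open import Function using (flip; _∘_; _∘′_)
open import Induction.WellFounded using (Acc; module Subrelation)
open import Relation.Binary.Construct.Closure.ReflexiveTransitive using (Star; ε; _◅_)
import Relation.Binary.Construct.On as On
open import Relation.Binary.PropositionalEquality
  using (_≡_; _≢_; refl; sym; trans; cong; subst; module ≡-Reasoning)
open import Relation.Nullary using (¬_; contradiction)
open import Algebra.Properties.CommutativeSemigroup +-commutativeSemigroup using (x∙yz≈y∙xz)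

-- Every move either places a piece, using up its value, or trades pieces for
-- pieces of the same total value (F_i + F_{i+1} = F_{i+2}, 2F_i = F_{i-2} + F_{i+1},
-- ...); a piece pushed into the black hole takes exactly F_m with it.  So
-- "remaining + weight of the board" stays congruent to n modulo F_m.
-- For termination, charge a piece in column j the potential (m - j) F_j: every
-- decomposition move lowers the total potential, and a placement in column j
-- adds less potential than the m F_j it removes from m * remaining.
-- A position without moves has nothing left to place, at most one piece per
-- column and no two adjacent pieces; such a board weighs less than F_m, so its
-- weight is n mod F_m.

weightedSum : ∀ {k} → (ℕ → ℕ) → ℕ → Vec ℕ k → ℕ
weightedSum c i [] = 0
weightedSum c i (x ∷ xs) = x * c i + weightedSum c (suc i) xs

weightFrom≡weightedSum-F : ∀ {k} i (xs : Vec ℕ k) → weightFrom i xs ≡ weightedSum F i xs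
weightFrom≡weightedSum-F i [] = refl
weightFrom≡weightedSum-F i (x ∷ xs) = cong (x * F i +_) (weightFrom≡weightedSum-F (suc i) xs)

weightedSum-replicate-0 : ∀ k c i → weightedSum c i (replicate k 0) ≡ 0
weightedSum-replicate-0 zero c i = refl
weightedSum-replicate-0 (suc k) c i = weightedSum-replicate-0 k c (suc i)

weightedSum-modp-suc : ∀ {k} c i p (xs : Vec ℕ k) → p < k →
  weightedSum c i (modp suc p xs) ≡ c (i + p) + weightedSum c i xs
weightedSum-modp-suc c i zero (x ∷ xs) _ rewrite +-identityʳ i = +-assoc (c i) (x * c i) _
weightedSum-modp-suc c i (suc p) (x ∷ xs) (s≤s p<k)
  rewrite weightedSum-modp-suc c (suc i) p xs p<k | +-suc i p =
  x∙yz≈y∙xz (x * c i) (c (suc (i + p))) _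

modp-beyond : ∀ {k} f p (xs : Vec ℕ k) → k ≤ p → modp f p xs ≡ xs
modp-beyond f p [] _ = refl
modp-beyond f (suc p) (x ∷ xs) (s≤s k≤p) = cong (x ∷_) (modp-beyond f p xs k≤p)

getp-pos⇒< : ∀ {k} p (xs : Vec ℕ k) → 1 ≤ getp xs p → p < k
getp-pos⇒< zero (x ∷ xs) _ = s≤s z≤n
getp-pos⇒< (suc p) (x ∷ xs) h = s≤s (getp-pos⇒< p xs h)

getp-modp-other : ∀ {k} f p q (xs : Vec ℕ k) → p ≢ q → getp (modp f p xs) q ≡ getp xs q
getp-modp-other f p q [] _ = refl
getp-modp-other f zero zero (x ∷ xs) p≢q = contradiction refl p≢q
getp-modp-other f zero (suc q) (x ∷ xs) _ = refl
getp-modp-other f (suc p) zero (x ∷ xs) _ = refl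
getp-modp-other f (suc p) (suc q) (x ∷ xs) p≢q = getp-modp-other f p q xs (p≢q ∘′ cong suc)

getp-modp-pred : ∀ {k} p (xs : Vec ℕ k) → getp (modp (_∸ 1) p xs) p ≡ getp xs p ∸ 1
getp-modp-pred p [] = refl
getp-modp-pred zero (x ∷ xs) = refl
getp-modp-pred (suc p) (x ∷ xs) = getp-modp-pred p xs

modp-suc-modp-pred : ∀ {k} p (xs : Vec ℕ k) → 1 ≤ getp xs p → modp suc p (modp (_∸ 1) p xs) ≡ xs
modp-suc-modp-pred zero (suc x ∷ xs) _ = refl
modp-suc-modp-pred (suc p) (x ∷ xs) h = cong (x ∷_) (modp-suc-modp-pred p xs h)

get-pos⇒≤ : ∀ {k} j (b : Vec ℕ k) → 1 ≤ get b j → j ≤ k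
get-pos⇒≤ (suc p) b h = getp-pos⇒< p b h

get-dec-other : ∀ {k} j l (b : Vec ℕ k) → j ≢ l → get (dec j b) l ≡ get b l
get-dec-other zero l b _ = refl
get-dec-other (suc p) zero b _ = refl
get-dec-other (suc p) (suc q) b j≢l = getp-modp-other _ p q b (j≢l ∘′ cong suc)

-- e = 1 exactly when j = suc k is the black hole, which swallows the piece.
weightedSum-inc : ∀ {k} c j (b : Vec ℕ k) → 1 ≤ j → j ≤ suc k →
  ∃[ e ] weightedSum c 1 (inc j b) + e * c (suc k) ≡ c j + weightedSum c 1 b
weightedSum-inc c (suc p) b _ (s≤s p≤k) with m≤n⇒m<n∨m≡n p≤k
... | inj₁ p<k = 0 , trans (+-identityʳ _) (weightedSum-modp-suc c 1 p b p<k)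
... | inj₂ refl rewrite modp-beyond suc p b ≤-refl =
  1 , trans (cong (weightedSum c 1 b +_) (*-identityˡ _)) (+-comm (weightedSum c 1 b) _)

weightedSum-dec : ∀ {k} c j (b : Vec ℕ k) → 1 ≤ get b j →
  weightedSum c 1 b ≡ c j + weightedSum c 1 (dec j b)
weightedSum-dec c (suc p) b h = begin
  weightedSum c 1 b                             ≡⟨ cong (weightedSum c 1) (sym (modp-suc-modp-pred p b h)) ⟩
  weightedSum c 1 (inc (suc p) (dec (suc p) b)) ≡⟨ weightedSum-modp-suc c 1 p (dec (suc p) b) (getp-pos⇒< p b h) ⟩
  c (suc p) + weightedSum c 1 (dec (suc p) b)   ∎
  where open ≡-Reasoning

total : (ℕ → ℕ) → List ℕ → ℕ
total c js = sum (map c js)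

addAll : ∀ {k} → List ℕ → Vec ℕ k → Vec ℕ k
addAll js b = foldr inc b js

removeAll : ∀ {k} → List ℕ → Vec ℕ k → Vec ℕ k
removeAll js b = foldr dec b js

Removable : ∀ {k} → List ℕ → Vec ℕ k → Set
Removable [] b = ⊤
Removable (j ∷ js) b = 1 ≤ get (removeAll js b) j × Removable js b

ColumnOrHole : ℕ → ℕ → Set
ColumnOrHole k j = 1 ≤ j × j ≤ suc k

weightedSum-addAll : ∀ {k} c js (b : Vec ℕ k) → All (ColumnOrHole k) js →
  ∃[ e ] weightedSum c 1 (addAll js b) + e * c (suc k) ≡ total c js + weightedSum c 1 b
weightedSum-addAll c [] b [] = 0 , +-identityʳ _
weightedSum-addAll {k} c (j ∷ js) b ((1≤j , j≤1+k) ∷ hs)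
  with weightedSum-addAll c js b hs | weightedSum-inc c j (addAll js b) 1≤j j≤1+k
... | e₁ , added | e₂ , addedⱼ = e₂ + e₁ , (begin
  W′ + (e₂ + e₁) * h                  ≡⟨ cong (W′ +_) (*-distribʳ-+ h e₂ e₁) ⟩
  W′ + (e₂ * h + e₁ * h)              ≡⟨ sym (+-assoc W′ _ _) ⟩
  W′ + e₂ * h + e₁ * h                ≡⟨ cong (_+ e₁ * h) addedⱼ ⟩
  c j + W + e₁ * h                    ≡⟨ +-assoc (c j) W _ ⟩
  c j + (W + e₁ * h)                  ≡⟨ cong (c j +_) added ⟩
  c j + (total c js + weightedSum c 1 b) ≡⟨ sym (+-assoc (c j) _ _) ⟩
  total c (j ∷ js) + weightedSum c 1 b   ∎)
  where
  open ≡-Reasoning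
  h W W′ : ℕ
  h = c (suc k)
  W = weightedSum c 1 (addAll js b)
  W′ = weightedSum c 1 (inc j (addAll js b))

weightedSum-removeAll : ∀ {k} c js (b : Vec ℕ k) → Removable js b →
  weightedSum c 1 b ≡ total c js + weightedSum c 1 (removeAll js b)
weightedSum-removeAll c [] b tt = refl
weightedSum-removeAll c (j ∷ js) b (available , hs) = begin
  weightedSum c 1 b                              ≡⟨ weightedSum-removeAll c js b hs ⟩
  total c js + weightedSum c 1 (removeAll js b)  ≡⟨ cong (total c js +_) (weightedSum-dec c j _ available) ⟩
  total c js + (c j + R)                         ≡⟨ x∙yz≈y∙xz (total c js) (c j) R ⟩
  c j + (total c js + R)                         ≡⟨ sym (+-assoc (c j) _ R) ⟩
  total c (j ∷ js) + R                           ∎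
  where
  open ≡-Reasoning
  R : ℕ
  R = weightedSum c 1 (removeAll (j ∷ js) b)

removable-pair : ∀ {k} j (b : Vec ℕ k) → 2 ≤ get b j → Removable (j ∷ j ∷ []) b
removable-pair (suc p) b h rewrite getp-modp-pred p b = ∸-monoˡ-≤ 1 h , <⇒≤ h , tt

removable-adjacent : ∀ {k} i (b : Vec ℕ k) → 1 ≤ get b i → 1 ≤ get b (suc i) →
  Removable (suc i ∷ i ∷ []) b
removable-adjacent i b hᵢ hᵢ₊₁ rewrite get-dec-other i (suc i) b (<⇒≢ (n<1+n i)) =
  hᵢ₊₁ , hᵢ , tt

F-pos : ∀ j → 1 ≤ F j
F-pos zero = s≤s z≤n
F-pos (suc zero) = s≤s z≤n
F-pos (suc (suc zero)) = s≤s z≤n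
F-pos (suc (suc (suc j))) = ≤-trans (F-pos (suc (suc j))) (m≤m+n _ _)

F-≤-suc : ∀ j → F j ≤ F (suc j)
F-≤-suc zero = ≤-refl
F-≤-suc (suc zero) = s≤s z≤n
F-≤-suc (suc (suc j)) = m≤m+n _ _

F-rec : ∀ j → F (suc (suc j)) ≡ F (suc j) + F j
F-rec zero = refl
F-rec (suc j) = refl

F-add : ∀ i → total F (i + 2 ∷ []) ≡ total F (suc i ∷ i ∷ [])
F-add i = begin
  F (i + 2) + 0         ≡⟨ cong (λ j → F j + 0) (+-comm i 2) ⟩
  F (2 + i) + 0         ≡⟨ cong (_+ 0) (F-rec i) ⟩
  F (1 + i) + F i + 0   ≡⟨ +-assoc (F (1 + i)) (F i) 0 ⟩
  F (1 + i) + (F i + 0) ∎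
  where open ≡-Reasoning

F-split : ∀ {i} → 3 ≤ i → total F (suc i ∷ i ∸ 2 ∷ []) ≡ total F (i ∷ i ∷ [])
F-split {suc (suc (suc q))} (s≤s (s≤s (s≤s _))) = balance (F (suc q)) (F (suc (suc q)))
  where
  balance : ∀ a b → (b + a) + b + (a + 0) ≡ (b + a) + ((b + a) + 0)
  balance = solve-∀

zeckendorf-bound : ∀ {k} j (xs : Vec ℕ k) → (∀ p → getp xs p ≤ 1) →
  (∀ p → ¬ (getp xs p ≡ 1 × getp xs (suc p) ≡ 1)) →
  weightFrom (suc j) xs + F j ≤ F (suc j + k)
zeckendorf-bound j [] _ _ rewrite +-identityʳ j = F-≤-suc j
zeckendorf-bound {suc k} j (0 ∷ xs) ≤1 sparse = begin
  weightFrom (2 + j) xs + F j       ≤⟨ +-monoʳ-≤ (weightFrom (2 + j) xs) (F-≤-suc j) ⟩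
  weightFrom (2 + j) xs + F (1 + j) ≤⟨ zeckendorf-bound (suc j) xs (≤1 ∘ suc) (sparse ∘ suc) ⟩
  F (2 + j + k)                     ≡⟨ cong F (sym (+-suc (suc j) k)) ⟩
  F (suc j + suc k)                 ∎
  where open ≤-Reasoning
zeckendorf-bound j (1 ∷ []) _ _ = ≤-reflexive (begin
  (F (1 + j) + 0) + 0 + F j ≡⟨ cong (_+ F j) (trans (+-identityʳ _) (+-identityʳ _)) ⟩
  F (1 + j) + F j           ≡⟨ sym (F-rec j) ⟩
  F (2 + j)                 ≡⟨ cong F (sym (+-comm (suc j) 1)) ⟩
  F (suc j + 1)             ∎)
  where open ≡-Reasoning
zeckendorf-bound {suc (suc k)} j (1 ∷ 0 ∷ xs) ≤1 sparse = begin
  (F (1 + j) + 0) + w + F j ≡⟨ rearrange (F (1 + j)) w (F j) ⟩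
  w + (F (1 + j) + F j)     ≡⟨ cong (w +_) (sym (F-rec j)) ⟩
  w + F (2 + j)             ≤⟨ zeckendorf-bound (2 + j) xs (≤1 ∘ suc ∘ suc) (sparse ∘ suc ∘ suc) ⟩
  F (3 + j + k)             ≡⟨ cong F (sym (trans (+-suc (suc j) (suc k)) (cong suc (+-suc (suc j) k)))) ⟩
  F (suc j + suc (suc k))   ∎
  where
  open ≤-Reasoning
  w : ℕ
  w = weightFrom (3 + j) xs
  rearrange : ∀ a w c → (a + 0) + w + c ≡ w + (a + c)
  rearrange = solve-∀
zeckendorf-bound j (1 ∷ 1 ∷ xs) _ sparse = contradiction (refl , refl) (sparse 0)
zeckendorf-bound j (1 ∷ suc (suc x) ∷ xs) ≤1 _ = contradiction (≤1 1) λ { (s≤s ()) }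
zeckendorf-bound j (suc (suc x) ∷ xs) ≤1 _ = contradiction (≤1 0) λ { (s≤s ()) }

zeckendorf-weight-< : ∀ {k} (b : Vec ℕ k) → (∀ i → get b i ≤ 1) →
  (∀ i → ¬ (get b i ≡ 1 × get b (suc i) ≡ 1)) → weight b < F (suc k)
zeckendorf-weight-< {k} b ≤1 sparse =
  subst (_≤ F (suc k)) (+-comm (weight b) 1) (zeckendorf-bound 0 b (≤1 ∘ suc) (sparse ∘ suc))

m∸n≡1+[m∸[1+n]] : ∀ {m n} → n < m → m ∸ n ≡ suc (m ∸ suc n)
m∸n≡1+[m∸[1+n]] {suc m} {zero} _ = refl
m∸n≡1+[m∸[1+n]] {suc m} {suc n} (s≤s n<m) = m∸n≡1+[m∸[1+n]] n<m

<-by-gap : ∀ {a b} d → b ≡ a + suc d → a < b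
<-by-gap {a} d refl = m<m+n a z<s

potential : ℕ → ℕ → ℕ
potential M j = (M ∸ j) * F j

-- Writing t for the distance from the highest column involved to M, the
-- rewrites turn each claim into a polynomial inequality in t and values of F.
potential-add : ∀ {M} i → i + 2 ≤ M →
  total (potential M) (i + 2 ∷ []) < total (potential M) (suc i ∷ i ∷ [])
potential-add {M} i i+2≤M
  rewrite +-comm i 2 | F-rec i
        | m∸n≡1+[m∸[1+n]] (<-trans (n<1+n _) i+2≤M)
        | m∸n≡1+[m∸[1+n]] i+2≤M
  with F i | F-pos i
... | suc a | _ = <-by-gap _ (gap (M ∸ suc (suc i)) (F (suc i)) a)
  where
  gap : ∀ t b a → suc t * b + (suc (suc t) * suc a + 0) ≡ t * (b + suc a) + 0 + suc (b + a + suc a)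
  gap = solve-∀

potential-merge : ∀ {M} → 2 ≤ M →
  total (potential M) (2 ∷ []) < total (potential M) (1 ∷ 1 ∷ [])
potential-merge {M} 2≤M rewrite m∸n≡1+[m∸[1+n]] 2≤M = <-by-gap 1 (gap (M ∸ 2))
  where
  gap : ∀ t → suc t * 1 + (suc t * 1 + 0) ≡ t * 2 + 0 + 2
  gap = solve-∀

potential-split2 : ∀ {M} → 3 ≤ M →
  total (potential M) (3 ∷ 1 ∷ []) < total (potential M) (2 ∷ 2 ∷ [])
potential-split2 {M} 3≤M
  rewrite m∸n≡1+[m∸[1+n]] (<-trans (s≤s (s≤s z≤n)) 3≤M) | m∸n≡1+[m∸[1+n]] 3≤M =
  <-by-gap 1 (gap (M ∸ 3))
  where
  gap : ∀ t → suc t * 2 + (suc t * 2 + 0) ≡ t * 3 + (suc (suc t) * 1 + 0) + 2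
  gap = solve-∀

potential-split : ∀ {M i} → 3 ≤ i → i < M →
  total (potential M) (suc i ∷ i ∸ 2 ∷ []) < total (potential M) (i ∷ i ∷ [])
potential-split {M} {suc (suc (suc q))} (s≤s (s≤s (s≤s _))) i<M
  rewrite m∸n≡1+[m∸[1+n]] (<-trans (n<1+n _) (<-trans (n<1+n _) i<M))
        | m∸n≡1+[m∸[1+n]] (<-trans (n<1+n _) i<M)
        | m∸n≡1+[m∸[1+n]] i<M
  with F (suc q) | F-pos (suc q) | F (suc (suc q)) | F-≤-suc (suc q)
... | suc a | _ | b | a<b with m≤n⇒∃[o]m+o≡n a<b
... | d , refl = <-by-gap (a + d + d) (gap (M ∸ suc (suc (suc (suc q)))) a d)
  where
  gap : ∀ t a d →
    suc t * ((suc a + d) + suc a) + (suc t * ((suc a + d) + suc a) + 0)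
      ≡ t * (((suc a + d) + suc a) + (suc a + d)) + (suc (suc (suc t)) * suc a + 0) + suc (a + d + d)
  gap = solve-∀

potential<M*F : ∀ {M j} → 1 ≤ j → j ≤ M → potential M j < M * F j
potential<M*F {M} {j} 1≤j j≤M = *-monoˡ-< (F j) {{F-nonZero j}} (∸-monoʳ-< {M} {j} {0} 1≤j j≤M)

record Trade {k} (b b′ : Vec ℕ k) : Set where
  field
    taken given     : List ℕ
    available       : Removable taken b
    outcome         : b′ ≡ addAll given (removeAll taken b)
    in-range        : All (ColumnOrHole k) given
    value-kept      : total F given ≡ total F taken
    potential-drops : total (potential (suc k)) given < total (potential (suc k)) taken

trade-lowers-potential : ∀ {k} {b b′ : Vec ℕ k} → Trade b b′ →
  weightedSum (potential (suc k)) 1 b′ < weightedSum (potential (suc k)) 1 b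
trade-lowers-potential {k} {b} t rewrite Trade.outcome t
  with weightedSum-addAll (potential (suc k)) (Trade.given t) (removeAll (Trade.taken t) b) (Trade.in-range t)
... | e , added = begin-strict
  Q (addAll given rest)                    ≤⟨ m≤m+n _ _ ⟩
  Q (addAll given rest) + e * y (suc k)    ≡⟨ added ⟩
  total y given + Q rest                   <⟨ +-monoˡ-< (Q rest) potential-drops ⟩
  total y taken + Q rest                   ≡⟨ sym (weightedSum-removeAll y taken b available) ⟩
  Q b                                      ∎
  where
  open Trade t
  open ≤-Reasoning
  y : ℕ → ℕ
  y = potential (suc k)
  Q : Vec ℕ k → ℕ
  Q = weightedSum y 1
  rest : Vec ℕ k
  rest = removeAll taken b

trade-keeps-weight : ∀ {k} {b b′ : Vec ℕ k} → Trade b b′ →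
  ∃[ e ] weightedSum F 1 b′ + e * F (suc k) ≡ weightedSum F 1 b
trade-keeps-weight {k} {b} t rewrite Trade.outcome t
  with weightedSum-addAll F (Trade.given t) (removeAll (Trade.taken t) b) (Trade.in-range t)
... | e , added = e , (begin
  W (addAll given rest) + e * F (suc k) ≡⟨ added ⟩
  total F given + W rest                ≡⟨ cong (_+ W rest) value-kept ⟩
  total F taken + W rest                ≡⟨ sym (weightedSum-removeAll F taken b available) ⟩
  W b                                   ∎)
  where
  open Trade t
  open ≡-Reasoning
  W : Vec ℕ k → ℕ
  W = weightedSum F 1
  rest : Vec ℕ k
  rest = removeAll taken b

module Game (k : ℕ) where

  m : ℕ
  m = 2 + k

  W Q : Board m → ℕ
  W = weightedSum F 1
  Q = weightedSum (potential m) 1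

  measure : State m → ℕ
  measure (b , r) = m * r + Q b

  value : State m → ℕ
  value (b , r) = r + W b

  instance
    F-m-nonZero : NonZero (F m)
    F-m-nonZero = F-nonZero m

  decomposition-trade : ∀ {b s′} → Step m (b , 0) s′ → proj₂ s′ ≡ 0 × Trade b (proj₁ s′)
  decomposition-trade (place-first ())
  decomposition-trade (place-last h) = contradiction (≤-trans (F-pos (suc k)) h) λ ()
  decomposition-trade {b} (add i _ hᵢ hᵢ₊₁) = refl , record
    { taken           = suc i ∷ i ∷ []
    ; given           = i + 2 ∷ []
    ; available       = removable-adjacent i b hᵢ hᵢ₊₁
    ; outcome         = refl
    ; in-range        = (subst (1 ≤_) (+-comm 2 i) (s≤s z≤n) , i+2≤m) ∷ []
    ; value-kept      = F-add i
    ; potential-drops = potential-add i i+2≤m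
    }
    where
    i+2≤m : i + 2 ≤ m
    i+2≤m = subst (_≤ m) (+-comm 2 i) (s≤s (get-pos⇒≤ (suc i) b hᵢ₊₁))
  decomposition-trade {b} (merge h) = refl , record
    { taken           = 1 ∷ 1 ∷ []
    ; given           = 2 ∷ []
    ; available       = removable-pair 1 b h
    ; outcome         = refl
    ; in-range        = (s≤s z≤n , s≤s (s≤s z≤n)) ∷ []
    ; value-kept      = refl
    ; potential-drops = potential-merge {m} (s≤s (s≤s z≤n))
    }
  decomposition-trade {b} (split2 h) = refl , record
    { taken           = 2 ∷ 2 ∷ []
    ; given           = 3 ∷ 1 ∷ []
    ; available       = removable-pair 2 b h
    ; outcome         = refl
    ; in-range        = (s≤s z≤n , 3≤m) ∷ (s≤s z≤n , s≤s z≤n) ∷ []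
    ; value-kept      = refl
    ; potential-drops = potential-split2 3≤m
    }
    where
    3≤m : 3 ≤ m
    3≤m = s≤s (get-pos⇒≤ 2 b (<⇒≤ h))
  decomposition-trade {b} (split i 3≤i h) = refl , record
    { taken           = i ∷ i ∷ []
    ; given           = suc i ∷ i ∸ 2 ∷ []
    ; available       = removable-pair i b h
    ; outcome         = refl
    ; in-range        = (s≤s z≤n , i<m) ∷ (∸-monoˡ-≤ 2 3≤i , ≤-trans (m∸n≤m i 2) (<⇒≤ i<m)) ∷ []
    ; value-kept      = F-split 3≤i
    ; potential-drops = potential-split 3≤i i<m
    }
    where
    i<m : i < m
    i<m = s≤s (get-pos⇒≤ i b (<⇒≤ h))

  placement-lowers-measure : ∀ {b r} j → 1 ≤ j → j ≤ m → F j ≤ r →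
    measure (inc j b , r ∸ F j) < measure (b , r)
  placement-lowers-measure {b} {r} j 1≤j j≤m Fj≤r with weightedSum-inc (potential m) j b 1≤j j≤m
  ... | e , added = begin-strict
    m * r′ + Q (inc j b)           ≤⟨ +-monoʳ-≤ (m * r′) (≤-trans (m≤m+n _ _) (≤-reflexive added)) ⟩
    m * r′ + (potential m j + Q b) <⟨ +-monoʳ-< (m * r′) (+-monoˡ-< (Q b) (potential<M*F 1≤j j≤m)) ⟩
    m * r′ + (m * F j + Q b)       ≡⟨ sym (+-assoc (m * r′) _ _) ⟩
    m * r′ + m * F j + Q b         ≡⟨ cong (_+ Q b) (sym (*-distribˡ-+ m r′ (F j))) ⟩
    m * (r′ + F j) + Q b           ≡⟨ cong (λ x → m * x + Q b) (m∸n+n≡m Fj≤r) ⟩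
    m * r + Q b                    ∎
    where
    open ≤-Reasoning
    r′ : ℕ
    r′ = r ∸ F j

  step-lowers-measure : ∀ {s s′} → Step m s s′ → measure s′ < measure s
  step-lowers-measure (place-first {b} h) = placement-lowers-measure {b} 1 ≤-refl (s≤s z≤n) h
  step-lowers-measure (place-last {b} h) = placement-lowers-measure {b} (suc k) (s≤s z≤n) (n≤1+n _) h
  step-lowers-measure {b , 0} st with decomposition-trade st
  ... | refl , t = +-monoʳ-< (m * 0) (trade-lowers-potential t)

  accessible : ∀ s → Acc (flip (Step m)) s
  accessible s =
    Subrelation.accessible step-lowers-measure (On.accessible measure (<-wellFounded (measure s)))

  placement-keeps-value : ∀ {b r} j → 1 ≤ j → j ≤ m → F j ≤ r →
    ∃[ e ] value (inc j b , r ∸ F j) + e * F m ≡ value (b , r)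
  placement-keeps-value {b} {r} j 1≤j j≤m Fj≤r with weightedSum-inc F j b 1≤j j≤m
  ... | e , added = e , (begin
    r′ + W (inc j b) + e * F m   ≡⟨ +-assoc r′ _ _ ⟩
    r′ + (W (inc j b) + e * F m) ≡⟨ cong (r′ +_) added ⟩
    r′ + (F j + W b)             ≡⟨ sym (+-assoc r′ _ _) ⟩
    r′ + F j + W b               ≡⟨ cong (_+ W b) (m∸n+n≡m Fj≤r) ⟩
    r + W b                      ∎)
    where
    open ≡-Reasoning
    r′ : ℕ
    r′ = r ∸ F j

  step-keeps-value : ∀ {s s′} → Step m s s′ → ∃[ e ] value s′ + e * F m ≡ value s
  step-keeps-value (place-first {b} h) = placement-keeps-value {b} 1 ≤-refl (s≤s z≤n) h
  step-keeps-value (place-last {b} h) = placement-keeps-value {b} (suc k) (s≤s z≤n) (n≤1+n _) h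
  step-keeps-value {b , 0} st with decomposition-trade st
  ... | refl , t = trade-keeps-weight t

  -- lost counts the pieces swallowed by the black hole.
  Worth : ℕ → State m → Set
  Worth n s = ∃[ lost ] value s + lost * F m ≡ n

  step-keeps-worth : ∀ {n s s′} → Step m s s′ → Worth n s → Worth n s′
  step-keeps-worth {n} {s} {s′} st (lost , worth) with step-keeps-value st
  ... | e , kept = e + lost , (begin
    value s′ + (e + lost) * F m         ≡⟨ cong (value s′ +_) (*-distribʳ-+ (F m) e lost) ⟩
    value s′ + (e * F m + lost * F m)   ≡⟨ sym (+-assoc (value s′) _ _) ⟩
    value s′ + e * F m + lost * F m     ≡⟨ cong (_+ lost * F m) kept ⟩
    value s + lost * F m                ≡⟨ worth ⟩
    n                                   ∎)
    where open ≡-Reasoning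

  reachable-keeps-worth : ∀ {n s s′} → Star (Step m) s s′ → Worth n s → Worth n s′
  reachable-keeps-worth ε worth = worth
  reachable-keeps-worth (st ◅ sts) worth = reachable-keeps-worth sts (step-keeps-worth st worth)

  initial-worth : ∀ n → Worth n (initial m n)
  initial-worth n =
    0 , trans (+-identityʳ _) (trans (cong (n +_) (weightedSum-replicate-0 (suc k) F 1)) (+-identityʳ n))

  terminal⇒nothing-left : ∀ {b r} → Terminal m (b , r) → r ≡ 0
  terminal⇒nothing-left {r = zero} _ = refl
  terminal⇒nothing-left {r = suc r} t = contradiction (place-first (s≤s z≤n)) (t _)

  crowded⇒¬terminal : ∀ {b} i → 2 ≤ get b i → ¬ Terminal m (b , 0)
  crowded⇒¬terminal 1 h t = t _ (merge h)
  crowded⇒¬terminal 2 h t = t _ (split2 h)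
  crowded⇒¬terminal (suc (suc (suc q))) h t = t _ (split _ (s≤s (s≤s (s≤s z≤n))) h)

  adjacent⇒¬terminal : ∀ {b} i → get b i ≡ 1 → get b (suc i) ≡ 1 → ¬ Terminal m (b , 0)
  adjacent⇒¬terminal (suc p) hᵢ hᵢ₊₁ t =
    t _ (add (suc p) (s≤s z≤n) (≤-reflexive (sym hᵢ)) (≤-reflexive (sym hᵢ₊₁)))

  terminal-zeckendorf : ∀ {n s} → Terminal m s → Worth n s →
    proj₂ s ≡ 0 × IsZeckendorfOf (n modF m) (proj₁ s)
  terminal-zeckendorf {n} {b , r} t worth with terminal⇒nothing-left t
  ... | refl = refl , ≤1 , sparse , weight≡n%Fm
    where
    ≤1 : ∀ i → get b i ≤ 1
    ≤1 i = ≮⇒≥ λ 1<bᵢ → crowded⇒¬terminal i 1<bᵢ t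
    sparse : ∀ i → ¬ (get b i ≡ 1 × get b (suc i) ≡ 1)
    sparse i (hᵢ , hᵢ₊₁) = adjacent⇒¬terminal i hᵢ hᵢ₊₁ t
    weight≡n%Fm : weight b ≡ n modF m
    weight≡n%Fm = begin
      weight b                      ≡⟨ sym (m<n⇒m%n≡m (zeckendorf-weight-< b ≤1 sparse)) ⟩
      weight b % F m                ≡⟨ sym ([m+kn]%n≡m%n (weight b) lost (F m)) ⟩
      (weight b + lost * F m) % F m ≡⟨ cong (λ w → (w + lost * F m) % F m) (weightFrom≡weightedSum-F 1 b) ⟩
      (W b + lost * F m) % F m      ≡⟨ cong (_% F m) (proj₂ worth) ⟩
      n % F m                       ∎
      where
      open ≡-Reasoning
      lost : ℕ
      lost = proj₁ worth

theorem2p1 : (m n : ℕ) → 2 ≤ m → 1 ≤ n →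
    Acc (flip (Step m)) (initial m n) ×
    (∀ s → Star (Step m) (initial m n) s → Terminal m s →
      proj₂ s ≡ 0 × IsZeckendorfOf (n modF m) (proj₁ s))
theorem2p1 (suc zero) n (s≤s ()) _
theorem2p1 (suc (suc k)) n _ _ =
  accessible (initial m n) ,
  λ s reachable terminal →
    terminal-zeckendorf terminal (reachable-keeps-worth reachable (initial-worth n))
  where open Game k
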